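{- Let $R$ be an $[n]$-decorated $(m+1)$-ary tree and let $\ell$ be a dead leaf of $R$. Let $v$ be a captive node that is a sibling of $\ell$, and let $k\ge1$ be such that the rank of $\ell$ equals the rank of $v$ plus $k$. Then the vertex immediately following $\ell$ in the total order $\prec_R$ is the child of $v$ of rank $k$.
   Context: An $(m+1)$-ary tree ($m\ge1$) is a rooted plane tree in which every vertex has $m+1$ or $0$ children; childless vertices are leaves, others nodes. The rank of a non-root vertex is the number of its siblings preceding it in the child order. If a node has a child of rank $>0$ that is a node, its cadet is the highest-rank such child and the edge to it is a cadet edge. An $[n]$-decorated $(m+1)$-ary tree is an $(m+1)$-ary tree whose nodes are labeled by nonempty subsets of $[n]=\{1,\dots,n\}$ forming a set partition of $[n]$, each cadet edge being declared solid or dashed (others solid). A captive node is a node joined to its parent by a dashed edge. A dead leaf is a leaf having a sibling of smaller rank that is a captive node. For a vertex $u$, $\rho(u)$ is the word in $\{E_0,\dots,E_m\}$ recording the ranks of the edges on the path from the root to $u$, and $\dot\rho(u)$ is the sum of these ranks. For distinct vertices $u,w$: $u\prec_R w$ iff $\dot\rho(u)<\dot\rho(w)$, or $\dot\rho(u)=\dot\rho(w)$ and either $\rho(u)$ is a proper prefix of $\rho(w)$ or at the first differing position $\rho(u)$ has $E_b$ and $\rho(w)$ has $E_a$ with $a<b$. This is a total order on the vertices. -}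

module Defs where

open import Data.Nat using (ℕ; zero; suc; _+_; _<_; _≤_)
open import Data.Fin using (Fin; toℕ)
open import Data.Fin.Subset using (Subset; _∈_; Nonempty)
open import Data.Vec using (Vec; lookup; _∷_; [])
open import Data.List using (List; []; _∷_; _++_; map; [_])
open import Data.Nat.ListAction using (sum)
open import Data.Bool using (Bool; true; false)
open import Data.Maybe using (Maybe; just; nothing)
open import Data.Product using (Σ; ∃; _×_; _,_)
open import Data.Sum using (_⊎_)
open import Relation.Binary.PropositionalEquality using (_≡_; _≢_)
open import Relation.Nullary using (¬_; Dec; yes; no)
open import Data.Fin.Subset.Properties using (_∈?_)

-- Plane (m+1)-ary trees (arity `suc m`) whose nodes carry
--   * a label: a subset of [n] (Subset n, i.e. Fin n ↦ Bool)
--   * a Bool telling whether the cadet edge of this node (if any) is dashed.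
--     The flag is irrelevant when the node has no cadet.
data Tree (m n : ℕ) : Set where
  leaf : Tree m n
  node : Subset n → Bool → Vec (Tree m n) (suc m) → Tree m n

-- A vertex is addressed by its word ρ(u): the list of ranks of the edges
-- on the path from the root (root = []).
Word : ℕ → Set
Word m = List (Fin (suc m))

subtreeAt : ∀ {m n} → Tree m n → Word m → Maybe (Tree m n)
subtreeAt t [] = just t
subtreeAt leaf (i ∷ w) = nothing
subtreeAt (node _ _ cs) (i ∷ w) = subtreeAt (lookup cs i) w

IsVertex : ∀ {m n} → Tree m n → Word m → Set
IsVertex R w = Σ (Tree _ _) λ t → subtreeAt R w ≡ just t

IsNode : ∀ {m n} → Tree m n → Set
IsNode leaf = Data.Empty.⊥ where import Data.Empty
IsNode (node _ _ _) = Data.Unit.⊤ where import Data.Unit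

countIn : ∀ {m n} → Fin n → Tree m n → ℕ
countInVec : ∀ {m n k} → Fin n → Vec (Tree m n) k → ℕ
countIn i leaf = 0
countIn i (node s _ cs) with i ∈? s
... | yes _ = suc (countInVec i cs)
... | no _ = countInVec i cs
countInVec i [] = 0
countInVec i (t ∷ ts) = countIn i t + countInVec i ts

AllLabelsNonempty : ∀ {m n} → Tree m n → Set
AllLabelsNonemptyVec : ∀ {m n k} → Vec (Tree m n) k → Set
AllLabelsNonempty leaf = Data.Unit.⊤ where import Data.Unit
AllLabelsNonempty (node s _ cs) = Nonempty s × AllLabelsNonemptyVec cs
AllLabelsNonemptyVec [] = Data.Unit.⊤ where import Data.Unit
AllLabelsNonemptyVec (t ∷ ts) = AllLabelsNonempty t × AllLabelsNonemptyVec ts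

-- [n]-decorated: node labels are nonempty and form a set partition of [n]
-- (every element of [n] lies in exactly one node label).
Decorated : ∀ {m n} → Tree m n → Set
Decorated {n = n} R = AllLabelsNonempty R × ((i : Fin n) → countIn i R ≡ 1)

IsCadet : ∀ {m n} → Vec (Tree m n) (suc m) → Fin (suc m) → Set
IsCadet cs i = (0 < toℕ i) × IsNode (lookup cs i)
             × ((j : Fin (suc _)) → toℕ i < toℕ j → lookup cs j ≡ leaf)

Captive : ∀ {m n} → Tree m n → Word m → Set
Captive R [] = Data.Empty.⊥ where import Data.Empty
Captive {m} {n} R (x ∷ w) =
  Σ (Word m) λ p → Σ (Fin (suc m)) λ i → (x ∷ w) ≡ p ++ [ i ] ×
  Σ (Subset n) λ s → Σ (Vec (Tree m n) (suc m)) λ cs →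
    subtreeAt R p ≡ just (node s true cs) × IsCadet cs i

DeadLeaf : ∀ {m n} → Tree m n → Word m → Set
DeadLeaf {m} R l = subtreeAt R l ≡ just leaf ×
  Σ (Word m) λ p → Σ (Fin (suc m)) λ j → l ≡ p ++ [ j ] ×
  Σ (Fin (suc m)) λ i → toℕ i < toℕ j × Captive R (p ++ [ i ])

rankSum : ∀ {m} → Word m → ℕ
rankSum w = sum (map toℕ w)

ProperPrefix : ∀ {m} → Word m → Word m → Set
ProperPrefix {m} u w = Σ (Fin (suc m)) λ a → Σ (Word m) λ t → w ≡ u ++ (a ∷ t)

FirstDiffGreater : ∀ {m} → Word m → Word m → Set
FirstDiffGreater {m} u w = Σ (Word m) λ c → Σ (Fin (suc m)) λ a → Σ (Fin (suc m)) λ b →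
  Σ (Word m) λ s → Σ (Word m) λ t →
  toℕ a < toℕ b × u ≡ c ++ (b ∷ s) × w ≡ c ++ (a ∷ t)

_≺_ : ∀ {m} → Word m → Word m → Set
u ≺ w = rankSum u < rankSum w
      ⊎ (rankSum u ≡ rankSum w × (ProperPrefix u w ⊎ FirstDiffGreater u w))

ImmediatelyFollows : ∀ {m n} → Tree m n → Word m → Word m → Set
ImmediatelyFollows {m} R u w = IsVertex R w × u ≺ w ×
  ((x : Word m) → IsVertex R x → u ≺ x → ¬ (x ≺ w))

-- The vertices of rank sum ρ̇(ℓ) are compared by a reversed lexicographic order,
-- so anything strictly between ℓ = p j and w = p i k extends p by a word starting
-- with a letter a, i ≤ a ≤ j.  For a = j it would be a descendant of the leaf ℓ;
-- for i < a < j the child p a is a leaf (i is the cadet), whose rank sum is too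
-- small; for a = i the word is p i or p i c with c > k, whose rank sums are too
-- small resp. too large.
module Submission where

open import Defs
open import Data.Nat using (ℕ; suc; _+_; _≤_; _<_)
open import Data.Nat.Properties
  using (+-identityʳ; +-cancelˡ-≡; <-irrefl; <-asym; <⇒≱; m≤m+n; m≤n+m; m<m+n; ≤-<-trans)
open import Data.Nat.ListAction using (sum)
open import Data.Nat.ListAction.Properties using (sum-++)
open import Data.Fin using (Fin; toℕ; fromℕ<)
open import Data.Fin.Properties using (toℕ<n; toℕ-fromℕ<)
open import Data.Fin.Subset using (Subset)
open import Data.List using ([]; _∷_; _++_; [_]; map)
open import Data.List.Properties using (∷ʳ-injective; ++-assoc; map-++)
open import Data.Vec using (Vec; lookup)
open import Data.Maybe using (just)
open import Data.Maybe.Properties using (just-injective)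
open import Data.Bool using (Bool; true)
open import Data.Product using (Σ; _×_; _,_)
open import Data.Sum using (_⊎_; inj₁; inj₂)
open import Data.Empty using (⊥; ⊥-elim)
open import Relation.Binary.PropositionalEquality using (_≡_; refl; sym; trans; cong; subst; module ≡-Reasoning)
open import Relation.Nullary using (¬_)

private
  variable
    m n : ℕ

infix 4 _⊏_
data _⊏_ {m : ℕ} : Word m → Word m → Set where
  []⊏∷  : ∀ {a t} → [] ⊏ a ∷ t
  here  : ∀ {a b s t} → toℕ a < toℕ b → b ∷ s ⊏ a ∷ t
  there : ∀ {a s t} → s ⊏ t → a ∷ s ⊏ a ∷ t

ProperPrefix⇒⊏ : (u w : Word m) → ProperPrefix u w → u ⊏ w
ProperPrefix⇒⊏ []      _ (a , t , refl) = []⊏∷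
ProperPrefix⇒⊏ (b ∷ u) _ (a , t , refl) = there (ProperPrefix⇒⊏ u _ (a , t , refl))

FirstDiffGreater⇒⊏ : (u w : Word m) → FirstDiffGreater u w → u ⊏ w
FirstDiffGreater⇒⊏ _ _ ([]    , a , b , s , t , a<b , refl , refl) = here a<b
FirstDiffGreater⇒⊏ _ _ (x ∷ c , a , b , s , t , a<b , refl , refl) =
  there (FirstDiffGreater⇒⊏ _ _ (c , a , b , s , t , a<b , refl , refl))

tiebreak⇒⊏ : (u w : Word m) → ProperPrefix u w ⊎ FirstDiffGreater u w → u ⊏ w
tiebreak⇒⊏ u w (inj₁ pp)  = ProperPrefix⇒⊏ u w pp
tiebreak⇒⊏ u w (inj₂ fdg) = FirstDiffGreater⇒⊏ u w fdg

⊏-between-++ : (p : Word m) {s t x : Word m} → p ++ s ⊏ x → x ⊏ p ++ t →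
  Σ (Word m) λ y → x ≡ p ++ y × s ⊏ y × y ⊏ t
⊏-between-++ []      {x = y} s⊏y y⊏t      = y , refl , s⊏y , y⊏t
⊏-between-++ (a ∷ p) (here c<a) (here a<c) = ⊥-elim (<-asym c<a a<c)
⊏-between-++ (a ∷ p) (here a<a) (there _)  = ⊥-elim (<-irrefl refl a<a)
⊏-between-++ (a ∷ p) (there _) (here a<a)  = ⊥-elim (<-irrefl refl a<a)
⊏-between-++ (a ∷ p) (there ps⊏x) (there x⊏pt)
  with y , refl , s⊏y , y⊏t ← ⊏-between-++ p ps⊏x x⊏pt = y , refl , s⊏y , y⊏t

rankSum-++ : (u v : Word m) → rankSum (u ++ v) ≡ rankSum u + rankSum v
rankSum-++ u v = trans (cong sum (map-++ toℕ u v)) (sum-++ (map toℕ u) (map toℕ v))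

≺-between : {u w x : Word m} → rankSum u ≡ rankSum w → u ≺ x → x ≺ w →
  rankSum x ≡ rankSum u × u ⊏ x × x ⊏ w
≺-between {x = x} u≡w (inj₁ u<x) (inj₁ x<w) =
  ⊥-elim (<-asym u<x (subst (rankSum x <_) (sym u≡w) x<w))
≺-between u≡w (inj₁ u<x) (inj₂ (x≡w , _)) = ⊥-elim (<-irrefl (trans u≡w (sym x≡w)) u<x)
≺-between u≡w (inj₂ (u≡x , _)) (inj₁ x<w) = ⊥-elim (<-irrefl (trans (sym u≡x) u≡w) x<w)
≺-between {u = u} {w} {x} _ (inj₂ (u≡x , u⊏x)) (inj₂ (_ , x⊏w)) =
  sym u≡x , tiebreak⇒⊏ u x u⊏x , tiebreak⇒⊏ x w x⊏w

subtreeAt-++ : (R : Tree m n) (u v : Word m) {T : Tree m n} →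
  subtreeAt R u ≡ just T → subtreeAt R (u ++ v) ≡ subtreeAt T v
subtreeAt-++ R             []      v refl = refl
subtreeAt-++ (node _ _ cs) (a ∷ u) v eq   = subtreeAt-++ (lookup cs a) u v eq

leaf-has-no-descendant : {t : Tree m n} (a : Fin (suc m)) (y : Word m) →
  t ≡ leaf → ¬ IsVertex t (a ∷ y)
leaf-has-no-descendant a y refl (_ , ())

node-has-child : {t : Tree m n} → IsNode t → (k : Fin (suc m)) → IsVertex t [ k ]
node-has-child {t = node s b cs} _ k = lookup cs k , refl

captive-parent : (R : Tree m n) (p : Word m) (i : Fin (suc m)) → Captive R (p ++ [ i ]) →
  Σ (Subset n) λ s → Σ (Vec (Tree m n) (suc m)) λ cs →
    subtreeAt R p ≡ just (node s true cs) × IsCadet cs i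
captive-parent R [] i (p′ , i′ , eq , s , cs , p′↦cs , cadet)
  with refl , refl ← ∷ʳ-injective [] p′ eq = s , cs , p′↦cs , cadet
captive-parent R (a ∷ p) i (p′ , i′ , eq , s , cs , p′↦cs , cadet)
  with refl , refl ← ∷ʳ-injective (a ∷ p) p′ eq = s , cs , p′↦cs , cadet

no-vertex-between : {s : Subset n} {b : Bool} {cs : Vec (Tree m n) (suc m)} {i j k : Fin (suc m)} →
  IsCadet cs i → lookup cs j ≡ leaf → toℕ j ≡ toℕ i + toℕ k → 0 < toℕ k →
  (y : Word m) → IsVertex (node s b cs) y → rankSum y ≡ toℕ j →
  [ j ] ⊏ y → y ⊏ i ∷ [ k ] → ⊥
no-vertex-between _ j↦leaf _ _ (j ∷ c ∷ z) y∈R _ (there []⊏∷) _ =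
  leaf-has-no-descendant c z j↦leaf y∈R
no-vertex-between (_ , _ , beyond-cadet-leaf) _ _ _ (a ∷ []) _ ρ̇y≡j (here a<j) (here i<a) =
  <-irrefl (trans (sym (+-identityʳ (toℕ a))) ρ̇y≡j) a<j
no-vertex-between (_ , _ , beyond-cadet-leaf) _ _ _ (a ∷ c ∷ z) y∈R _ (here _) (here i<a) =
  leaf-has-no-descendant c z (beyond-cadet-leaf a i<a) y∈R
no-vertex-between {i = i} {k = k} _ _ j≡i+k 0<k (i ∷ []) _ ρ̇y≡j (here _) (there []⊏∷) =
  <-irrefl (+-cancelˡ-≡ (toℕ i) 0 (toℕ k) (trans ρ̇y≡j j≡i+k)) 0<k
no-vertex-between {i = i} {k = k} _ _ j≡i+k _ (i ∷ c ∷ z) _ ρ̇y≡j (here _) (there (here k<c)) =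
  <⇒≱ k<c (subst (toℕ c ≤_) c+ρ̇z≡k (m≤m+n (toℕ c) (rankSum z)))
  where
  c+ρ̇z≡k : toℕ c + rankSum z ≡ toℕ k
  c+ρ̇z≡k = +-cancelˡ-≡ (toℕ i) _ _ (trans ρ̇y≡j j≡i+k)

rankSum-∷ʳ : (p : Word m) (a : Fin (suc m)) → rankSum (p ++ [ a ]) ≡ rankSum p + toℕ a
rankSum-∷ʳ p a = trans (rankSum-++ p [ a ]) (cong (rankSum p +_) (+-identityʳ (toℕ a)))

grandchild-immediately-follows-leaf :
  (R : Tree m n) (p : Word m) {s : Subset n} {b : Bool} {cs : Vec (Tree m n) (suc m)}
  {i j k : Fin (suc m)} →
  subtreeAt R p ≡ just (node s b cs) → IsCadet cs i → subtreeAt R (p ++ [ j ]) ≡ just leaf →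
  toℕ j ≡ toℕ i + toℕ k → 0 < toℕ k →
  ImmediatelyFollows R (p ++ [ j ]) ((p ++ [ i ]) ++ [ k ])
grandchild-immediately-follows-leaf {m = m} R p {s} {b} {cs} {i} {j} {k}
  p↦node cadet@(_ , i-node , _) ℓ↦leaf j≡i+k 0<k = w∈R , ℓ≺w , nothing-between
  where
  open ≡-Reasoning

  w≡p++ik : (p ++ [ i ]) ++ [ k ] ≡ p ++ i ∷ [ k ]
  w≡p++ik = ++-assoc p [ i ] [ k ]

  w∈R : IsVertex R ((p ++ [ i ]) ++ [ k ])
  w∈R with t , ik↦t ← node-has-child i-node k =
    t , trans (subtreeAt-++ R (p ++ [ i ]) [ k ] (subtreeAt-++ R p [ i ] p↦node)) ik↦t

  ρ̇ℓ≡ρ̇w : rankSum (p ++ [ j ]) ≡ rankSum ((p ++ [ i ]) ++ [ k ])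
  ρ̇ℓ≡ρ̇w = begin
    rankSum (p ++ [ j ])              ≡⟨ rankSum-∷ʳ p j ⟩
    rankSum p + toℕ j                 ≡⟨ cong (λ r → rankSum p + r) j≡i+k ⟩
    rankSum p + (toℕ i + toℕ k)       ≡⟨ cong (λ r → rankSum p + (toℕ i + r)) (+-identityʳ (toℕ k)) ⟨
    rankSum p + rankSum (i ∷ [ k ])   ≡⟨ rankSum-++ p (i ∷ [ k ]) ⟨
    rankSum (p ++ i ∷ [ k ])          ≡⟨ cong rankSum w≡p++ik ⟨
    rankSum ((p ++ [ i ]) ++ [ k ])   ∎

  ℓ≺w : (p ++ [ j ]) ≺ ((p ++ [ i ]) ++ [ k ])
  ℓ≺w = inj₂ (ρ̇ℓ≡ρ̇w , inj₂ (p , i , j , [] , [ k ] , i<j , refl , w≡p++ik))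
    where
    i<j : toℕ i < toℕ j
    i<j = subst (toℕ i <_) (sym j≡i+k) (m<m+n (toℕ i) 0<k)

  nothing-between : (x : Word m) → IsVertex R x → (p ++ [ j ]) ≺ x → ¬ (x ≺ ((p ++ [ i ]) ++ [ k ]))
  nothing-between x (t , x↦t) ℓ≺x x≺w
    with ρ̇x≡ρ̇ℓ , ℓ⊏x , x⊏w ← ≺-between ρ̇ℓ≡ρ̇w ℓ≺x x≺w
    with y , refl , j⊏y , y⊏ik ← ⊏-between-++ p ℓ⊏x (subst (x ⊏_) w≡p++ik x⊏w) =
    no-vertex-between cadet j↦leaf j≡i+k 0<k y y∈node ρ̇y≡j j⊏y y⊏ik
    where
    j↦leaf : lookup cs j ≡ leaf
    j↦leaf = just-injective (trans (sym (subtreeAt-++ R p [ j ] p↦node)) ℓ↦leaf)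
    y∈node : IsVertex (node s b cs) y
    y∈node = t , trans (sym (subtreeAt-++ R p y p↦node)) x↦t
    ρ̇y≡j : rankSum y ≡ toℕ j
    ρ̇y≡j = +-cancelˡ-≡ (rankSum p) _ _
      (trans (sym (rankSum-++ p y)) (trans ρ̇x≡ρ̇ℓ (rankSum-∷ʳ p j)))

lemma3p1 : (m n : ℕ) → 1 ≤ m → (R : Tree m n) → Decorated R →
    (p : Word m) (j i : Fin (suc m)) (k : ℕ) →
    DeadLeaf R (p ++ [ j ]) → Captive R (p ++ [ i ]) →
    1 ≤ k → toℕ j ≡ toℕ i + k →
    Σ (Fin (suc m)) λ k′ → toℕ k′ ≡ k ×
      ImmediatelyFollows R (p ++ [ j ]) ((p ++ [ i ]) ++ [ k′ ])
lemma3p1 m n _ R _ p j i k (ℓ↦leaf , _) captive 0<k j≡i+k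
  with s , cs , p↦node , cadet ← captive-parent R p i captive =
  fromℕ< k<1+m , toℕ-fromℕ< k<1+m ,
  grandchild-immediately-follows-leaf R p p↦node cadet ℓ↦leaf
    (trans j≡i+k (cong (toℕ i +_) (sym (toℕ-fromℕ< k<1+m))))
    (subst (0 <_) (sym (toℕ-fromℕ< k<1+m)) 0<k)
  where
  k<1+m : k < suc m
  k<1+m = ≤-<-trans (m≤n+m k (toℕ i)) (subst (_< suc m) j≡i+k (toℕ<n j))
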